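{- Let \(\mathcal V\) be a universe. There is a nontrivial locally small \(\delta_{\mathcal V}\)-complete poset with decidable equality if and only if weak excluded middle in \(\mathcal V\) holds.
   Context: Work in univalent foundations (intensional Martin-Löf type theory with universes, function and propositional extensionality, propositional truncations). "There is" means one can construct such a structure, with carrier in any universe. A poset is a type \(X\) with a proposition-valued reflexive, transitive, antisymmetric relation \(\sqsubseteq\). It is \(\delta_{\mathcal V}\)-complete if for all \(x\sqsubseteq y\) and every proposition \(P:\mathcal V\), the family \(\delta_{x,y,P}:\mathbf 1+P\to X\), \(\mathrm{inl}(\star)\mapsto x\), \(\mathrm{inr}(p)\mapsto y\), has a supremum. It is nontrivial if it comes with designated \(x,y\) with \(x\sqsubseteq y\) and \(x\neq y\). It is locally small if there is a \(\mathcal V\)-valued relation \(\sqsubseteq_{\mathcal V}\) with \((x\sqsubseteq y)\simeq(x\sqsubseteq_{\mathcal V}y)\) for all \(x,y\). Decidable equality: for all \(x,y\), \((x=y)+\lnot(x=y)\). Weak excluded middle in \(\mathcal V\): for every proposition \(P:\mathcal V\), \(\lnot P\) or \(\lnot\lnot P\) holds. -}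

module Defs where

open import Level using (Level; _⊔_) renaming (suc to lsuc)
open import Data.Unit using (⊤; tt)
open import Data.Empty using (⊥)
open import Data.Sum using (_⊎_; inj₁; inj₂)
open import Data.Product using (Σ; _×_; _,_)
open import Relation.Nullary using (¬_)
open import Relation.Binary.PropositionalEquality using (_≡_)
open import Function.Bundles using (_↔_)

isProp : ∀ {a} → Set a → Set a
isProp A = (x y : A) → x ≡ y

record IsPoset {u w : Level} (X : Set u) (_⊑_ : X → X → Set w) : Set (u ⊔ w) where
  field
    ⊑-prop  : (x y : X) → isProp (x ⊑ y)
    ⊑-refl  : (x : X) → x ⊑ x
    ⊑-trans : (x y z : X) → x ⊑ y → y ⊑ z → x ⊑ z
    ⊑-antisym : (x y : X) → x ⊑ y → y ⊑ x → x ≡ y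

IsSup : ∀ {u w i} {X : Set u} (_⊑_ : X → X → Set w) {I : Set i} → (I → X) → X → Set (u ⊔ w ⊔ i)
IsSup {X = X} _⊑_ {I} f s = ((k : I) → f k ⊑ s) × ((b : X) → ((k : I) → f k ⊑ b) → s ⊑ b)

HasSup : ∀ {u w i} {X : Set u} (_⊑_ : X → X → Set w) {I : Set i} → (I → X) → Set (u ⊔ w ⊔ i)
HasSup {X = X} _⊑_ f = Σ X (IsSup _⊑_ f)

δ : ∀ {u v} {X : Set u} (x y : X) (P : Set v) → ⊤ ⊎ P → X
δ x y P (inj₁ _) = x
δ x y P (inj₂ _) = y

δ-complete : ∀ {u w} (V : Level) {X : Set u} (_⊑_ : X → X → Set w) → Set (u ⊔ w ⊔ lsuc V)
δ-complete V {X} _⊑_ =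
  (x y : X) → x ⊑ y → (P : Set V) → isProp P → HasSup _⊑_ (δ x y P)

Nontrivial : ∀ {u w} {X : Set u} (_⊑_ : X → X → Set w) → Set (u ⊔ w)
Nontrivial {X = X} _⊑_ = Σ X λ x → Σ X λ y → (x ⊑ y) × ¬ (x ≡ y)

LocallySmall : ∀ {u w} (V : Level) {X : Set u} (_⊑_ : X → X → Set w) → Set (u ⊔ w ⊔ lsuc V)
LocallySmall V {X} _⊑_ = Σ (X → X → Set V) λ R → (x y : X) → (x ⊑ y) ↔ R x y

HasDecidableEquality : ∀ {u} → Set u → Set u
HasDecidableEquality X = (x y : X) → (x ≡ y) ⊎ ¬ (x ≡ y)

WEM : (V : Level) → Set (lsuc V)
WEM V = (P : Set V) → isProp P → ¬ P ⊎ ¬ ¬ P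

NLSDPoset : (V u w : Level) → Set (lsuc u ⊔ lsuc w ⊔ lsuc V)
NLSDPoset V u w =
  Σ (Set u) λ X → Σ (X → X → Set w) λ _⊑_ →
    IsPoset X _⊑_ × Nontrivial _⊑_ × LocallySmall V _⊑_ × δ-complete V _⊑_
    × HasDecidableEquality X

{-# OPTIONS --safe #-}
-- If x ⊑ y are distinct, the supremum s of δ_{x,y,P} is x exactly when ¬ P holds, and
-- otherwise ¬ ¬ P holds; deciding s = x therefore decides between ¬ P and ¬ ¬ P.
-- Conversely, in the two-element poset false ≤ true the order is decidable, so for each
-- proposition P weak excluded middle tells us whether x or y is the supremum of δ_{x,y,P}.
module Submission where

open import Defs
open import Level using (Level; Lift; lift; lower)
open import Function.Bundles using (_⇔_; mk⇔; mk↔ₛ′)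
open import Data.Bool using (Bool; true; false; _≤_; f≤t)
open import Data.Bool.Properties using (≤-refl; ≤-trans; ≤-antisym; ≤-irrelevant; _≤?_; _≟_)
open import Data.Unit using (tt)
open import Data.Empty using (⊥-elim)
open import Data.Sum using (inj₁; inj₂)
open import Data.Product using (_,_)
open import Relation.Nullary using (¬_; Stable)
open import Relation.Nullary.Decidable using (decidable-stable; toSum; map′)
open import Relation.Binary.PropositionalEquality using (_≡_; _≢_; refl; cong)

module _ {u w} {X : Set u} {_⊑_ : X → X → Set w} (po : IsPoset X _⊑_) where
  open IsPoset po

  IsSup-unique : ∀ {i} {I : Set i} {f : I → X} {s t : X} →
                 IsSup _⊑_ f s → IsSup _⊑_ f t → s ≡ t
  IsSup-unique (s-ub , s-least) (t-ub , t-least) =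
    ⊑-antisym _ _ (s-least _ t-ub) (t-least _ s-ub)

  module _ {v} {x y : X} {P : Set v} where

    ¬⇒IsSup-δ-left : ¬ P → IsSup _⊑_ (δ x y P) x
    ¬⇒IsSup-δ-left ¬p =
      (λ { (inj₁ _) → ⊑-refl x ; (inj₂ p) → ⊥-elim (¬p p) }) , λ _ bound → bound (inj₁ tt)

    ¬¬⇒IsSup-δ-right : (∀ a b → Stable (a ⊑ b)) → x ⊑ y → ¬ ¬ P → IsSup _⊑_ (δ x y P) y
    ¬¬⇒IsSup-δ-right stable x⊑y ¬¬p =
      (λ { (inj₁ _) → x⊑y ; (inj₂ _) → ⊑-refl y }) ,
      λ b bound → stable y b (λ y⋢b → ¬¬p (λ p → y⋢b (bound (inj₂ p))))

    IsSup-δ-left⇒¬ : x ⊑ y → x ≢ y → IsSup _⊑_ (δ x y P) x → ¬ P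
    IsSup-δ-left⇒¬ x⊑y x≢y (ub , _) p = x≢y (⊑-antisym x y x⊑y (ub (inj₂ p)))

  decidable-nontrivial-δ-complete⇒WEM : ∀ {V} → HasDecidableEquality X → Nontrivial _⊑_ →
                                         δ-complete V _⊑_ → WEM V
  decidable-nontrivial-δ-complete⇒WEM deq (x , y , x⊑y , x≢y) complete P P-prop
    with complete x y x⊑y P P-prop
  ... | s , s-sup with deq s x
  ... | inj₁ refl = inj₁ (IsSup-δ-left⇒¬ x⊑y x≢y s-sup)
  ... | inj₂ s≢x  = inj₂ (λ ¬p → s≢x (IsSup-unique s-sup (¬⇒IsSup-δ-left ¬p)))

  WEM⇒δ-complete : ∀ {V} → (∀ a b → Stable (a ⊑ b)) → WEM V → δ-complete V _⊑_
  WEM⇒δ-complete stable wem x y x⊑y P P-prop with wem P P-prop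
  ... | inj₁ ¬p  = x , ¬⇒IsSup-δ-left ¬p
  ... | inj₂ ¬¬p = y , ¬¬⇒IsSup-δ-right stable x⊑y ¬¬p

module TwoElementPoset (u w : Level) where

  𝟚 : Set u
  𝟚 = Lift u Bool

  _⊑_ : 𝟚 → 𝟚 → Set w
  a ⊑ b = Lift w (lower a ≤ lower b)

  ⊑-isPoset : IsPoset 𝟚 _⊑_
  ⊑-isPoset = record
    { ⊑-prop    = λ _ _ (lift p) (lift q) → cong lift (≤-irrelevant p q)
    ; ⊑-refl    = λ _ → lift ≤-refl
    ; ⊑-trans   = λ _ _ _ (lift p) (lift q) → lift (≤-trans p q)
    ; ⊑-antisym = λ _ _ (lift p) (lift q) → cong lift (≤-antisym p q)
    }

  ⊑-stable : ∀ a b → Stable (a ⊑ b)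
  ⊑-stable a b = decidable-stable (map′ lift lower (lower a ≤? lower b))

  ⊑-nontrivial : Nontrivial _⊑_
  ⊑-nontrivial = lift false , lift true , lift f≤t , λ ()

  ⊑-locallySmall : ∀ V → LocallySmall V _⊑_
  ⊑-locallySmall V =
    (λ a b → Lift V (lower a ≤ lower b)) ,
    λ _ _ → mk↔ₛ′ (λ p → lift (lower p)) (λ p → lift (lower p)) (λ _ → refl) (λ _ → refl)

  𝟚-decidableEquality : HasDecidableEquality 𝟚
  𝟚-decidableEquality a b = toSum (map′ (cong lift) (cong lower) (lower a ≟ lower b))

theorem4p26 : (V u w : Level) → NLSDPoset V u w ⇔ WEM V
theorem4p26 V u w = mk⇔ poset⇒WEM WEM⇒poset
  where
  open TwoElementPoset u w

  poset⇒WEM : NLSDPoset V u w → WEM V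
  poset⇒WEM (_ , _ , po , nontrivial , _ , complete , deq) =
    decidable-nontrivial-δ-complete⇒WEM po deq nontrivial complete

  WEM⇒poset : WEM V → NLSDPoset V u w
  WEM⇒poset wem =
    𝟚 , _⊑_ , ⊑-isPoset , ⊑-nontrivial , ⊑-locallySmall V ,
    WEM⇒δ-complete ⊑-isPoset ⊑-stable wem , 𝟚-decidableEquality
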